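{- Let $I=(S,\mathcal{F},k,c,p,B)$ be a BLM instance and let $X\in\mathcal{F}\setminus\{S\}$ be a maximal set. Then for all $q\in\{0,1,\ldots,|S|\}$ and $t\in P_I$, $$\mathrm{DP}_I(q,t)=\begin{cases}\min_{q_1,q_2,t_1,t_2\in\mathbb{N},\ q_1+q_2=q,\ t_1+t_2=t}\left\{\mathrm{DP}_{I\cap X}(q_1,t_1)+\mathrm{DP}_{I\setminus X}(q_2,t_2)\right\} & \text{if } q\leq k(S),\\ \infty & \text{otherwise.}\end{cases}$$
   Context: A family $\mathcal{F}\subseteq 2^S\setminus\{\emptyset\}$ on a finite set $S$ is laminar if for all $X,Y\in\mathcal{F}$ either $X\cap Y=\emptyset$, $X\subseteq Y$, or $Y\subseteq X$. For a laminar family $\mathcal{F}$ on $S$ and $k:\mathcal{F}\to\mathbb{N}_{>0}$, let $\mathcal{I}_{\mathcal{F},k}=\{A\subseteq S : |A\cap X|\leq k(X)\ \forall X\in\mathcal{F}\}$. A BLM instance is a tuple $I=(S,\mathcal{F},k,c,p,B)$ with $S$ finite, $\mathcal{F}$ a laminar family on $S$ with $S\in\mathcal{F}$, $k:\mathcal{F}\to\mathbb{N}_{>0}$, $c,p:S\to\mathbb{N}$, $B\in\mathbb{N}$. For $R\subseteq S$, $c(R)=\sum_{e\in R}c(e)$, $p(R)=\sum_{e\in R}p(e)$. Let $P_I=\{0,1,\ldots,|S|\cdot\max_{e\in S}p(e)\}$. The DP table of $I$ is $\mathrm{DP}_I:\{0,\ldots,|S|\}\times P_I\to\mathbb{N}\cup\{\infty\}$,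 $\mathrm{DP}_I(q,t)=\min\{c(Q): Q\in\mathcal{I}_{\mathcal{F},k},\ |Q|=q,\ p(Q)=t\}$, with the minimum of an empty set equal to $\infty$; by convention $\mathrm{DP}_I(q,t)=\infty$ whenever $(q,t)$ lies outside the domain $\{0,\ldots,|S|\}\times P_I$. A set $X\in\mathcal{F}\setminus\{S\}$ is maximal if it is not contained in any other set of $\mathcal{F}\setminus\{S\}$. For $G\subseteq S$ let $\mathcal{F}_{\subseteq G}=\{Y\in\mathcal{F}: Y\subseteq G\}$. For a maximal $X$, $I\cap X=(X,\mathcal{F}_{\subseteq X},k,c,p,B)$ (with functions restricted) and $I\setminus X=(S\setminus X,\ \mathcal{F}_{\subseteq(S\setminus X)}\cup\{S\setminus X\},\ \bar{k},c,p,B)$, where $\bar{k}(Y)=k(Y)$ if $Y\in\mathcal{F}$ and $\bar{k}(Y)=k(S)$ otherwise. -}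

module Defs where

open import Data.Bool using (Bool; true; false; if_then_else_)
open import Data.Nat using (ℕ; zero; suc; _+_; _*_; _∸_; _≤_; _<_; _≤?_; _⊔_; _⊓_)
open import Data.Fin using (Fin)
open import Data.Fin.Subset using (Subset; _∈_; _⊆_; _∩_; ∁; ∣_∣; Nonempty; inside; outside)
open import Data.Fin.Subset.Properties using (_∈?_; _⊆?_)
open import Data.Vec using (Vec; []; _∷_)
import Data.Vec.Properties as VecP
import Data.Bool.Properties as BoolP
open import Data.List using (List; []; _∷_; _++_; [_]; map; filter; foldr; allFin; upTo)
open import Data.Nat.ListAction using (sum)
open import Data.List.Membership.Propositional using () renaming (_∈_ to _∈ˡ_)
open import Data.List.Membership.DecPropositional using ()
open import Data.List.Relation.Unary.Any using (any?)
open import Data.Product using (_×_; _,_)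
open import Data.Sum using (_⊎_)
open import Relation.Nullary using (¬_; Dec; yes; no; does)
open import Relation.Nullary.Decidable using (_×-dec_)
open import Relation.Binary.PropositionalEquality using (_≡_)
open import Data.List.Relation.Unary.All using (All; all?)

data ℕ∞ : Set where
  fin : ℕ → ℕ∞
  ∞   : ℕ∞

_⊓∞_ : ℕ∞ → ℕ∞ → ℕ∞
fin a ⊓∞ fin b = fin (a ⊓ b)
fin a ⊓∞ ∞     = fin a
∞     ⊓∞ y     = y

_+∞_ : ℕ∞ → ℕ∞ → ℕ∞
fin a +∞ fin b = fin (a + b)
fin a +∞ ∞     = ∞
∞     +∞ y     = ∞

min∞ : List ℕ∞ → ℕ∞
min∞ = foldr _⊓∞_ ∞

_≟ˢ_ : ∀ {n} (A B : Subset n) → Dec (A ≡ B)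
_≟ˢ_ = VecP.≡-dec BoolP._≟_

allSubsets : ∀ n → List (Subset n)
allSubsets zero    = [ [] ]
allSubsets (suc n) = map (outside ∷_) (allSubsets n) ++ map (inside ∷_) (allSubsets n)

elems : ∀ {n} → Subset n → List (Fin n)
elems {n} A = filter (_∈? A) (allFin n)

Σ[_]_ : ∀ {n} → (Fin n → ℕ) → Subset n → ℕ
Σ[ f ] A = sum (map f (elems A))

-- max_{e ∈ A} f(e)  (0 on the empty set; never used on an empty set here)
Max[_]_ : ∀ {n} → (Fin n → ℕ) → Subset n → ℕ
Max[ f ] A = foldr _⊔_ 0 (map f (elems A))

-- BLM instances over the universe Fin n.
-- The family 𝓕 is a finite list of subsets; k is given as a function on
-- all subsets, of which only the values on members of 𝓕 matter.

record BLM (n : ℕ) : Set where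
  constructor blm
  field
    S : Subset n
    𝓕 : List (Subset n)
    k : Subset n → ℕ
    c : Fin n → ℕ
    p : Fin n → ℕ
    B : ℕ

open BLM public

Laminar : ∀ {n} → List (Subset n) → Set
Laminar 𝓕 = ∀ X Y → X ∈ˡ 𝓕 → Y ∈ˡ 𝓕 →
  (X ∩ Y ≡ Data.Fin.Subset.⊥) ⊎ (X ⊆ Y ⊎ Y ⊆ X)

ValidBLM : ∀ {n} → BLM n → Set
ValidBLM I =
  (∀ X → X ∈ˡ 𝓕 I → Nonempty X × X ⊆ S I) ×
  Laminar (𝓕 I) ×
  S I ∈ˡ 𝓕 I ×
  (∀ X → X ∈ˡ 𝓕 I → 0 < k I X)

Indep : ∀ {n} → BLM n → Subset n → Set
Indep I A = A ⊆ S I × All (λ X → ∣ A ∩ X ∣ ≤ k I X) (𝓕 I)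

Indep? : ∀ {n} (I : BLM n) (A : Subset n) → Dec (Indep I A)
Indep? I A = (A ⊆? S I) ×-dec all? (λ X → ∣ A ∩ X ∣ ≤? k I X) (𝓕 I)

-- P_I = {0, …, |S| · max_{e∈S} p(e)}; pmax I is its largest element
pmax : ∀ {n} → BLM n → ℕ
pmax I = ∣ S I ∣ * Max[ p I ] S I

Cand : ∀ {n} → BLM n → ℕ → ℕ → Subset n → Set
Cand I q t Q = Indep I Q × ∣ Q ∣ ≡ q × Σ[ p I ] Q ≡ t

Cand? : ∀ {n} (I : BLM n) q t (Q : Subset n) → Dec (Cand I q t Q)
Cand? I q t Q = Indep? I Q ×-dec (∣ Q ∣ Data.Nat.≟ q ×-dec Σ[ p I ] Q Data.Nat.≟ t)

DP : ∀ {n} → BLM n → ℕ → ℕ → ℕ∞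
DP {n} I q t with q ≤? ∣ S I ∣ | t ≤? pmax I
... | yes _ | yes _ = min∞ (map (λ Q → fin (Σ[ c I ] Q)) (filter (Cand? I q t) (allSubsets n)))
... | _     | _     = ∞

Maximal : ∀ {n} → BLM n → Subset n → Set
Maximal I X = X ∈ˡ 𝓕 I × ¬ (X ≡ S I) ×
  (∀ Y → Y ∈ˡ 𝓕 I → ¬ (Y ≡ S I) → X ⊆ Y → Y ≡ X)

𝓕⊆ : ∀ {n} → List (Subset n) → Subset n → List (Subset n)
𝓕⊆ 𝓕 G = filter (_⊆? G) 𝓕

_∩ᴵ_ : ∀ {n} → BLM n → Subset n → BLM n
I ∩ᴵ X = blm X (𝓕⊆ (𝓕 I) X) (k I) (c I) (p I) (B I)

_∖ᴵ_ : ∀ {n} → BLM n → Subset n → BLM n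
_∖ᴵ_ {n} I X = blm SX (𝓕⊆ (𝓕 I) SX ++ [ SX ]) kbar (c I) (p I) (B I)
  where
  SX = S I ∩ ∁ X
  kbar : Subset n → ℕ
  kbar Y = if does (any? (Y ≟ˢ_) (𝓕 I)) then k I Y else k I (S I)

combine : ∀ {n} → BLM n → Subset n → ℕ → ℕ → ℕ∞
combine I X q t =
  min∞ (Data.List.concatMap (λ q₁ → map (λ t₁ →
      DP (I ∩ᴵ X) q₁ t₁ +∞ DP (I ∖ᴵ X) (q ∸ q₁) (t ∸ t₁))
    (upTo (suc t))) (upTo (suc q)))

-- An independent set Q of I splits into Q ∩ X, independent in I ∩ X, and Q ∖ X, independent in
-- I ∖ X, with sizes, profits and costs adding up. Conversely, by laminarity every Y ∈ 𝓕 lies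
-- inside X, is disjoint from X, or contains X, and by maximality of X the last case means Y = X
-- or Y = S; so the union of independent sets of I ∩ X and I ∖ X is independent in I exactly
-- when its size is at most k(S). Hence for q ≤ k(S) both sides are the minimum of c over the
-- same family of sets, while for q > k(S) there is no independent set of size q at all.

module Submission where

open import Defs
open import Data.Nat using (ℕ; _≤_)
open import Data.Fin.Subset using (Subset; ∣_∣)
open import Data.Product using (_×_)
open import Relation.Nullary using (¬_)
open import Relation.Binary.PropositionalEquality using (_≡_)

open import Data.Bool using (true; false)
open import Data.Nat using (zero; suc; _+_; _*_; _∸_; _⊔_; _≤?_; z≤n; s≤s)
open import Data.Nat.Properties
open import Algebra.Properties.CommutativeSemigroup +-commutativeSemigroup using (x∙yz≈y∙xz)
open import Data.Fin using (Fin; zero; suc)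
open import Data.Fin.Subset using (_∈_; _⊆_; _∩_; _∪_; ∁; inside; outside) renaming (⊥ to ∅)
open import Data.Fin.Subset.Properties
  using (_∈?_; _⊆?_; ⊆-antisym; ⊆-reflexive; p⊆q⇒∣p∣≤∣q∣; p⊆q⇒∁p⊇∁q; x∈p∩q⁺; x∈p∩q⁻; x∈p∪q⁻;
         p⊆p∪q; q⊆p∪q; p∩q⊆p; p∩q⊆q; ∩-comm; x∈∁p⇒x∉p; x∉p⇒x∈∁p; x∈p⇒x∉∁p; ∉⊥)
open import Data.Vec using ([]; _∷_)
open import Data.List using (List; []; _∷_; map; filter; foldr; tabulate; allFin; upTo; concatMap)
import Data.List.Properties as List
open import Data.List.Membership.Propositional using (find; lose) renaming (_∈_ to _∈ˡ_)
open import Data.List.Membership.Propositional.Properties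
  using (∈-map⁺; ∈-map⁻; ∈-++⁺ˡ; ∈-++⁺ʳ; ∈-concatMap⁺; ∈-concatMap⁻;
         ∈-upTo⁺; ∈-upTo⁻; ∈-filter⁺; ∈-filter⁻)
open import Data.List.Relation.Unary.Any using (here; there; any?)
open import Data.List.Relation.Unary.All using ([]; _∷_)
import Data.List.Relation.Unary.All as All
open import Data.List.Relation.Unary.All.Properties using (++⁺)
open import Data.Product using (∃; ∃₂; _,_; proj₁; proj₂)
open import Data.Sum using (_⊎_; inj₁; inj₂)
open import Function using (_∘_; id)
open import Relation.Nullary using (does; yes; no; contradiction)
open import Relation.Unary using (Decidable)
open import Relation.Binary.PropositionalEquality
  using (refl; sym; trans; cong; cong₂; subst; subst₂)

infix 4 _≤∞_

data _≤∞_ : ℕ∞ → ℕ∞ → Set where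
  fin≤fin : ∀ {a b} → a ≤ b → fin a ≤∞ fin b
  ≤∞-top  : ∀ {x} → x ≤∞ ∞

≤∞-refl : ∀ {x} → x ≤∞ x
≤∞-refl {fin a} = fin≤fin ≤-refl
≤∞-refl {∞}     = ≤∞-top

≤∞-trans : ∀ {x y z} → x ≤∞ y → y ≤∞ z → x ≤∞ z
≤∞-trans (fin≤fin a≤b) (fin≤fin b≤c) = fin≤fin (≤-trans a≤b b≤c)
≤∞-trans _             ≤∞-top        = ≤∞-top

≤∞-antisym : ∀ {x y} → x ≤∞ y → y ≤∞ x → x ≡ y
≤∞-antisym (fin≤fin a≤b) (fin≤fin b≤a) = cong fin (≤-antisym a≤b b≤a)
≤∞-antisym ≤∞-top        ≤∞-top        = refl

x⊓∞y≤∞x : ∀ x y → x ⊓∞ y ≤∞ x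
x⊓∞y≤∞x (fin a) (fin b) = fin≤fin (m⊓n≤m a b)
x⊓∞y≤∞x (fin a) ∞       = ≤∞-refl
x⊓∞y≤∞x ∞       y       = ≤∞-top

x⊓∞y≤∞y : ∀ x y → x ⊓∞ y ≤∞ y
x⊓∞y≤∞y (fin a) (fin b) = fin≤fin (m⊓n≤n a b)
x⊓∞y≤∞y (fin a) ∞       = ≤∞-top
x⊓∞y≤∞y ∞       y       = ≤∞-refl

⊓∞-sel : ∀ x y → x ⊓∞ y ≡ x ⊎ x ⊓∞ y ≡ y
⊓∞-sel (fin a) (fin b) with ⊓-sel a b
... | inj₁ eq = inj₁ (cong fin eq)
... | inj₂ eq = inj₂ (cong fin eq)
⊓∞-sel (fin a) ∞       = inj₁ refl
⊓∞-sel ∞       y       = inj₂ refl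

+∞-mono-≤∞ : ∀ {x y u v} → x ≤∞ y → u ≤∞ v → x +∞ u ≤∞ y +∞ v
+∞-mono-≤∞ (fin≤fin a≤b) (fin≤fin c≤d) = fin≤fin (+-mono-≤ a≤b c≤d)
+∞-mono-≤∞ (fin≤fin _)   ≤∞-top        = ≤∞-top
+∞-mono-≤∞ ≤∞-top        _             = ≤∞-top

x+∞∞≡∞ : ∀ x → x +∞ ∞ ≡ ∞
x+∞∞≡∞ (fin a) = refl
x+∞∞≡∞ ∞       = refl

min∞-≤∞ : ∀ {xs y} → y ∈ˡ xs → min∞ xs ≤∞ y
min∞-≤∞ {x ∷ xs} (here refl) = x⊓∞y≤∞x x (min∞ xs)
min∞-≤∞ {x ∷ xs} (there y∈) = ≤∞-trans (x⊓∞y≤∞y x (min∞ xs)) (min∞-≤∞ y∈)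

min∞-∞⊎∈ : ∀ xs → min∞ xs ≡ ∞ ⊎ min∞ xs ∈ˡ xs
min∞-∞⊎∈ []       = inj₁ refl
min∞-∞⊎∈ (x ∷ xs) with ⊓∞-sel x (min∞ xs) | min∞-∞⊎∈ xs
... | inj₁ eq | _       = inj₂ (here eq)
... | inj₂ eq | inj₁ ∞≡ = inj₁ (trans eq ∞≡)
... | inj₂ eq | inj₂ ∈xs = inj₂ (there (subst (_∈ˡ xs) (sym eq) ∈xs))

record IsMin {A : Set} (C : A → Set) (g : A → ℕ) (v : ℕ∞) : Set where
  field
    lower    : ∀ {Q} → C Q → v ≤∞ fin (g Q)
    attained : v ≡ ∞ ⊎ ∃ λ Q → C Q × v ≡ fin (g Q)

IsMin-unique : ∀ {A : Set} {C : A → Set} {g : A → ℕ} {v w} →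
  IsMin C g v → IsMin C g w → v ≡ w
IsMin-unique mv mw with IsMin.attained mv | IsMin.attained mw
... | inj₁ refl            | inj₁ refl            = refl
... | inj₁ refl            | inj₂ (Q , CQ , refl) with () ← IsMin.lower mv CQ
... | inj₂ (Q , CQ , refl) | inj₁ refl            with () ← IsMin.lower mw CQ
... | inj₂ (Q , CQ , refl) | inj₂ (R , CR , refl) =
  ≤∞-antisym (IsMin.lower mv CR) (IsMin.lower mw CQ)

∞-isMin : ∀ {A : Set} {C : A → Set} {g : A → ℕ} → (∀ {Q} → ¬ C Q) → IsMin C g ∞
∞-isMin ¬C = record { lower = λ CQ → contradiction CQ ¬C ; attained = inj₁ refl }

min∞-isMin : ∀ {A : Set} {C : A → Set} (C? : Decidable C) (g : A → ℕ) {xs : List A} →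
  (∀ Q → Q ∈ˡ xs) → IsMin C g (min∞ (map (fin ∘ g) (filter C? xs)))
min∞-isMin {C = C} C? g {xs} complete = record { lower = lower ; attained = attained }
  where
  m = min∞ (map (fin ∘ g) (filter C? xs))
  lower : ∀ {Q} → C Q → m ≤∞ fin (g Q)
  lower {Q} CQ = min∞-≤∞ (∈-map⁺ (fin ∘ g) (∈-filter⁺ C? (complete Q) CQ))
  attained : m ≡ ∞ ⊎ ∃ λ Q → C Q × m ≡ fin (g Q)
  attained with min∞-∞⊎∈ (map (fin ∘ g) (filter C? xs))
  ... | inj₁ ∞≡ = inj₁ ∞≡
  ... | inj₂ ∈ys with Q , Q∈ , eq ← ∈-map⁻ (fin ∘ g) ∈ys =
    inj₂ (Q , proj₂ (∈-filter⁻ C? {xs = xs} Q∈) , eq)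

filter-∈?-map-suc : ∀ {n} b (A : Subset n) (xs : List (Fin n)) →
  filter (_∈? (b ∷ A)) (map suc xs) ≡ map suc (filter (_∈? A) xs)
filter-∈?-map-suc b A []       = refl
filter-∈?-map-suc b A (x ∷ xs) with does (x ∈? A)
... | true  = cong (suc x ∷_) (filter-∈?-map-suc b A xs)
... | false = filter-∈?-map-suc b A xs

elems-∷ : ∀ {n} b (A : Subset n) → filter (_∈? (b ∷ A)) (tabulate suc) ≡ map suc (elems A)
elems-∷ b A = trans (cong (filter (_∈? (b ∷ A))) (sym (List.map-tabulate id suc)))
                    (filter-∈?-map-suc b A (allFin _))

map-elems-∷ : ∀ {n} b (f : Fin (suc n) → ℕ) (A : Subset n) →
  map f (filter (_∈? (b ∷ A)) (tabulate suc)) ≡ map (f ∘ suc) (elems A)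
map-elems-∷ b f A = trans (cong (map f) (elems-∷ b A)) (sym (List.map-∘ (elems A)))

-- Σ[_]_ and Max[_]_ are definitionally foldElems _+_ and foldElems _⊔_.
module _ (_∙_ : ℕ → ℕ → ℕ) where

  foldElems : ∀ {n} → (Fin n → ℕ) → Subset n → ℕ
  foldElems f A = foldr _∙_ 0 (map f (elems A))

  foldElems-outside : ∀ {n} (f : Fin (suc n) → ℕ) A →
    foldElems f (outside ∷ A) ≡ foldElems (f ∘ suc) A
  foldElems-outside f A = cong (foldr _∙_ 0) (map-elems-∷ outside f A)

  foldElems-inside : ∀ {n} (f : Fin (suc n) → ℕ) A →
    foldElems f (inside ∷ A) ≡ f zero ∙ foldElems (f ∘ suc) A
  foldElems-inside f A = cong (λ ys → f zero ∙ foldr _∙_ 0 ys) (map-elems-∷ inside f A)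

Σ-split : ∀ {n} (f : Fin n → ℕ) (A X : Subset n) → Σ[ f ] A ≡ Σ[ f ] (A ∩ X) + Σ[ f ] (A ∩ ∁ X)
Σ-split f []            []            = refl
Σ-split f (outside ∷ A) (_ ∷ X)
  rewrite foldElems-outside _+_ f A | foldElems-outside _+_ f (A ∩ X)
        | foldElems-outside _+_ f (A ∩ ∁ X)
  = Σ-split (f ∘ suc) A X
Σ-split f (inside ∷ A)  (inside ∷ X)
  rewrite foldElems-inside _+_ f A | foldElems-inside _+_ f (A ∩ X)
        | foldElems-outside _+_ f (A ∩ ∁ X) | Σ-split (f ∘ suc) A X
  = sym (+-assoc (f zero) _ _)
Σ-split f (inside ∷ A)  (outside ∷ X)
  rewrite foldElems-inside _+_ f A | foldElems-outside _+_ f (A ∩ X)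
        | foldElems-inside _+_ f (A ∩ ∁ X) | Σ-split (f ∘ suc) A X
  = x∙yz≈y∙xz (f zero) (Σ[ f ∘ suc ] (A ∩ X)) _

∣∣≡Σ1 : ∀ {n} (A : Subset n) → ∣ A ∣ ≡ Σ[ (λ _ → 1) ] A
∣∣≡Σ1 []            = refl
∣∣≡Σ1 (outside ∷ A) = trans (∣∣≡Σ1 A) (sym (foldElems-outside _+_ (λ _ → 1) A))
∣∣≡Σ1 (inside ∷ A)  = trans (cong suc (∣∣≡Σ1 A)) (sym (foldElems-inside _+_ (λ _ → 1) A))

∣∣-split : ∀ {n} (A X : Subset n) → ∣ A ∣ ≡ ∣ A ∩ X ∣ + ∣ A ∩ ∁ X ∣
∣∣-split A X rewrite ∣∣≡Σ1 A | ∣∣≡Σ1 (A ∩ X) | ∣∣≡Σ1 (A ∩ ∁ X) = Σ-split _ A X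

Σ≤∣∣*Max : ∀ {n} (f : Fin n → ℕ) A → Σ[ f ] A ≤ ∣ A ∣ * Max[ f ] A
Σ≤∣∣*Max f []            = z≤n
Σ≤∣∣*Max f (outside ∷ A)
  rewrite foldElems-outside _+_ f A | foldElems-outside _⊔_ f A = Σ≤∣∣*Max (f ∘ suc) A
Σ≤∣∣*Max f (inside ∷ A)
  rewrite foldElems-inside _+_ f A | foldElems-inside _⊔_ f A =
  +-mono-≤ (m≤m⊔n (f zero) M)
           (≤-trans (Σ≤∣∣*Max (f ∘ suc) A) (*-monoʳ-≤ ∣ A ∣ (m≤n⊔m (f zero) M)))
  where M = Max[ f ∘ suc ] A

∩-monoˡ-⊆ : ∀ {n} {A C Y : Subset n} → A ⊆ C → A ∩ Y ⊆ C ∩ Y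
∩-monoˡ-⊆ {A = A} {Y = Y} A⊆C x∈ = let x∈A , x∈Y = x∈p∩q⁻ A Y x∈ in x∈p∩q⁺ (A⊆C x∈A , x∈Y)

⊆⇒∩≡ : ∀ {n} {A C : Subset n} → A ⊆ C → C ∩ A ≡ A
⊆⇒∩≡ {A = A} {C} A⊆C = ⊆-antisym (p∩q⊆q C A) (λ x∈A → x∈p∩q⁺ (A⊆C x∈A , x∈A))

∩≡∅⇒⊆∁ : ∀ {n} {X Y : Subset n} → X ∩ Y ≡ ∅ → Y ⊆ ∁ X
∩≡∅⇒⊆∁ X∩Y≡∅ x∈Y = x∉p⇒x∈∁p λ x∈X → ∉⊥ (subst (_ ∈_) X∩Y≡∅ (x∈p∩q⁺ (x∈X , x∈Y)))

∪-∩-⊆ˡ : ∀ {n} {A C Y : Subset n} → C ⊆ ∁ Y → (A ∪ C) ∩ Y ⊆ A ∩ Y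
∪-∩-⊆ˡ {A = A} {C} {Y} C⊆∁Y x∈ with x∈A∪C , x∈Y ← x∈p∩q⁻ (A ∪ C) Y x∈ | x∈p∪q⁻ A C x∈A∪C
... | inj₁ x∈A = x∈p∩q⁺ (x∈A , x∈Y)
... | inj₂ x∈C = contradiction x∈Y (x∈∁p⇒x∉p (C⊆∁Y x∈C))

∪-∩-⊆ʳ : ∀ {n} {A C Y : Subset n} → A ⊆ ∁ Y → (A ∪ C) ∩ Y ⊆ C ∩ Y
∪-∩-⊆ʳ {A = A} {C} {Y} A⊆∁Y x∈ with x∈A∪C , x∈Y ← x∈p∩q⁻ (A ∪ C) Y x∈ | x∈p∪q⁻ A C x∈A∪C
... | inj₁ x∈A = contradiction x∈Y (x∈∁p⇒x∉p (A⊆∁Y x∈A))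
... | inj₂ x∈C = x∈p∩q⁺ (x∈C , x∈Y)

∪-∩≡ˡ : ∀ {n} {A C X : Subset n} → A ⊆ X → C ⊆ ∁ X → (A ∪ C) ∩ X ≡ A
∪-∩≡ˡ {A = A} {C} {X} A⊆X C⊆∁X =
  ⊆-antisym (p∩q⊆p A X ∘ ∪-∩-⊆ˡ C⊆∁X) (λ x∈A → x∈p∩q⁺ (p⊆p∪q C x∈A , A⊆X x∈A))

∪-∩∁≡ʳ : ∀ {n} {A C X : Subset n} → A ⊆ X → C ⊆ ∁ X → (A ∪ C) ∩ ∁ X ≡ C
∪-∩∁≡ʳ {A = A} {C} {X} A⊆X C⊆∁X =
  ⊆-antisym (p∩q⊆p C (∁ X) ∘ ∪-∩-⊆ʳ A⊆∁∁X) (λ x∈C → x∈p∩q⁺ (q⊆p∪q A C x∈C , C⊆∁X x∈C))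
  where
  A⊆∁∁X : A ⊆ ∁ (∁ X)
  A⊆∁∁X x∈A = x∉p⇒x∈∁p (x∈p⇒x∉∁p (A⊆X x∈A))

Σ-mono-⊆ : ∀ {n} (f : Fin n → ℕ) {A C : Subset n} → A ⊆ C → Σ[ f ] A ≤ Σ[ f ] C
Σ-mono-⊆ f {A} {C} A⊆C = subst (λ Z → Σ[ f ] Z ≤ Σ[ f ] C) (⊆⇒∩≡ A⊆C)
  (subst (Σ[ f ] (C ∩ A) ≤_) (sym (Σ-split f C A)) (m≤m+n _ _))

Σ-∪ : ∀ {n} (f : Fin n → ℕ) {A C X : Subset n} → A ⊆ X → C ⊆ ∁ X →
  Σ[ f ] (A ∪ C) ≡ Σ[ f ] A + Σ[ f ] C
Σ-∪ f {A} {C} {X} A⊆X C⊆∁X = trans (Σ-split f (A ∪ C) X)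
  (cong₂ _+_ (cong (Σ[ f ]_) (∪-∩≡ˡ A⊆X C⊆∁X)) (cong (Σ[ f ]_) (∪-∩∁≡ʳ A⊆X C⊆∁X)))

∣∣-∪ : ∀ {n} {A C X : Subset n} → A ⊆ X → C ⊆ ∁ X → ∣ A ∪ C ∣ ≡ ∣ A ∣ + ∣ C ∣
∣∣-∪ {A = A} {C} A⊆X C⊆∁X rewrite ∣∣≡Σ1 (A ∪ C) | ∣∣≡Σ1 A | ∣∣≡Σ1 C = Σ-∪ _ A⊆X C⊆∁X

-- (min,+)-convolution; combine I X is by definition DP (I ∩ᴵ X) ⊛ DP (I ∖ᴵ X).
infixl 6 _⊛_

splitCosts : (ℕ → ℕ → ℕ∞) → (ℕ → ℕ → ℕ∞) → ℕ → ℕ → ℕ → List ℕ∞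
splitCosts F G q t q₁ = map (λ t₁ → F q₁ t₁ +∞ G (q ∸ q₁) (t ∸ t₁)) (upTo (suc t))

_⊛_ : (ℕ → ℕ → ℕ∞) → (ℕ → ℕ → ℕ∞) → ℕ → ℕ → ℕ∞
(F ⊛ G) q t = min∞ (concatMap (splitCosts F G q t) (upTo (suc q)))

⊛-≤∞ : ∀ (F G : ℕ → ℕ → ℕ∞) q₁ q₂ t₁ t₂ → (F ⊛ G) (q₁ + q₂) (t₁ + t₂) ≤∞ F q₁ t₁ +∞ G q₂ t₂
⊛-≤∞ F G q₁ q₂ t₁ t₂ =
  subst₂ (λ a b → (F ⊛ G) (q₁ + q₂) (t₁ + t₂) ≤∞ F q₁ t₁ +∞ G a b)
         (m+n∸m≡n q₁ q₂) (m+n∸m≡n t₁ t₂)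
    (min∞-≤∞ (∈-concatMap⁺ (splitCosts F G (q₁ + q₂) (t₁ + t₂))
      (lose (∈-upTo⁺ (s≤s (m≤m+n q₁ q₂))) (∈-map⁺ _ (∈-upTo⁺ (s≤s (m≤m+n t₁ t₂)))))))

⊛-attained : ∀ (F G : ℕ → ℕ → ℕ∞) q t → (F ⊛ G) q t ≡ ∞ ⊎
  ∃₂ λ q₁ t₁ → q₁ ≤ q × t₁ ≤ t × (F ⊛ G) q t ≡ F q₁ t₁ +∞ G (q ∸ q₁) (t ∸ t₁)
⊛-attained F G q t with min∞-∞⊎∈ (concatMap (splitCosts F G q t) (upTo (suc q)))
... | inj₁ ∞≡ = inj₁ ∞≡
... | inj₂ ∈all
  with q₁ , q₁∈ , ∈row ← find (∈-concatMap⁻ (splitCosts F G q t) {xs = upTo (suc q)} ∈all)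
  with t₁ , t₁∈ , eq ← ∈-map⁻ _ ∈row
  = inj₂ (q₁ , t₁ , ≤-pred (∈-upTo⁻ q₁∈) , ≤-pred (∈-upTo⁻ t₁∈) , eq)

∈-allSubsets : ∀ {n} (Q : Subset n) → Q ∈ˡ allSubsets n
∈-allSubsets []                    = here refl
∈-allSubsets {suc n} (outside ∷ Q) = ∈-++⁺ˡ (∈-map⁺ (outside ∷_) (∈-allSubsets Q))
∈-allSubsets {suc n} (inside ∷ Q)  =
  ∈-++⁺ʳ (map (outside ∷_) (allSubsets n)) (∈-map⁺ (inside ∷_) (∈-allSubsets Q))

Cand⇒inDomain : ∀ {n} (I : BLM n) {q t Q} → Cand I q t Q → q ≤ ∣ S I ∣ × t ≤ pmax I
Cand⇒inDomain I ((Q⊆S , _) , refl , refl) =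
  p⊆q⇒∣p∣≤∣q∣ Q⊆S , ≤-trans (Σ-mono-⊆ (p I) Q⊆S) (Σ≤∣∣*Max (p I) (S I))

DP-isMin : ∀ {n} (I : BLM n) q t → IsMin (Cand I q t) (Σ[ c I ]_) (DP I q t)
DP-isMin I q t with q ≤? ∣ S I ∣ | t ≤? pmax I
... | yes _ | yes _  = min∞-isMin (Cand? I q t) (Σ[ c I ]_) ∈-allSubsets
... | no q≰ | _      = ∞-isMin (q≰ ∘ proj₁ ∘ Cand⇒inDomain I)
... | yes _ | no t≰  = ∞-isMin (t≰ ∘ proj₂ ∘ Cand⇒inDomain I)

Indep⇒∣∣≤k : ∀ {n} (I : BLM n) {Q} → S I ∈ˡ 𝓕 I → Indep I Q → ∣ Q ∣ ≤ k I (S I)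
Indep⇒∣∣≤k I S∈𝓕 (Q⊆S , bounds) =
  ≤-trans (p⊆q⇒∣p∣≤∣q∣ (λ x∈Q → x∈p∩q⁺ (x∈Q , Q⊆S x∈Q))) (All.lookup bounds S∈𝓕)

k∖ᴵ-∈ : ∀ {n} (I : BLM n) X {Y} → Y ∈ˡ 𝓕 I → k (I ∖ᴵ X) Y ≡ k I Y
k∖ᴵ-∈ I X {Y} Y∈𝓕 with any? (Y ≟ˢ_) (𝓕 I)
... | yes _  = refl
... | no Y∉ = contradiction Y∈𝓕 Y∉

≤-k∖ᴵ : ∀ {n} (I : BLM n) X Y {m} → (Y ∈ˡ 𝓕 I → m ≤ k I Y) → m ≤ k I (S I) → m ≤ k (I ∖ᴵ X) Y
≤-k∖ᴵ I X Y ≤kY ≤kS with any? (Y ≟ˢ_) (𝓕 I)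
... | yes Y∈𝓕 = ≤kY Y∈𝓕
... | no _    = ≤kS

Indep-∩ᴵ : ∀ {n} (I : BLM n) X {Q} → Indep I Q → Indep (I ∩ᴵ X) (Q ∩ X)
Indep-∩ᴵ I X {Q} (_ , bounds) = p∩q⊆q Q X , All.tabulate λ Y∈ →
  ≤-trans (p⊆q⇒∣p∣≤∣q∣ (∩-monoˡ-⊆ (p∩q⊆p Q X)))
          (All.lookup bounds (proj₁ (∈-filter⁻ (_⊆? X) {xs = 𝓕 I} Y∈)))

Indep-∖ᴵ : ∀ {n} (I : BLM n) X {Q} → S I ∈ˡ 𝓕 I → Indep I Q → Indep (I ∖ᴵ X) (Q ∩ ∁ X)
Indep-∖ᴵ I X {Q} S∈𝓕 ind@(Q⊆S , bounds) = ∩-monoˡ-⊆ Q⊆S , ++⁺ (All.tabulate inner) (outer ∷ [])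
  where
  SX = S I ∩ ∁ X
  bound𝓕 : ∀ {Y} → Y ∈ˡ 𝓕 I → ∣ (Q ∩ ∁ X) ∩ Y ∣ ≤ k I Y
  bound𝓕 Y∈𝓕 = ≤-trans (p⊆q⇒∣p∣≤∣q∣ (∩-monoˡ-⊆ (p∩q⊆p Q (∁ X)))) (All.lookup bounds Y∈𝓕)
  inner : ∀ {Y} → Y ∈ˡ 𝓕⊆ (𝓕 I) SX → ∣ (Q ∩ ∁ X) ∩ Y ∣ ≤ k (I ∖ᴵ X) Y
  inner Y∈ with Y∈𝓕 , _ ← ∈-filter⁻ (_⊆? SX) {xs = 𝓕 I} Y∈ =
    subst (_ ≤_) (sym (k∖ᴵ-∈ I X Y∈𝓕)) (bound𝓕 Y∈𝓕)
  outer : ∣ (Q ∩ ∁ X) ∩ SX ∣ ≤ k (I ∖ᴵ X) SX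
  outer = ≤-k∖ᴵ I X SX bound𝓕
    (≤-trans (p⊆q⇒∣p∣≤∣q∣ (p∩q⊆p Q (∁ X) ∘ p∩q⊆p (Q ∩ ∁ X) SX)) (Indep⇒∣∣≤k I S∈𝓕 ind))

Indep-∪ : ∀ {n} {I : BLM n} {X A C} → ValidBLM I → Maximal I X →
  Indep (I ∩ᴵ X) A → Indep (I ∖ᴵ X) C → ∣ A ∪ C ∣ ≤ k I (S I) → Indep I (A ∪ C)
Indep-∪ {I = I} {X} {A} {C} (sets , laminar , _) (X∈𝓕 , _ , maximal)
        (A⊆X , boundsA) (C⊆SX , boundsC) ∣A∪C∣≤k =
  A∪C⊆S , All.tabulate λ Y∈𝓕 → bound Y∈𝓕 (laminar X _ X∈𝓕 Y∈𝓕)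
  where
  SX = S I ∩ ∁ X
  C⊆∁X : C ⊆ ∁ X
  C⊆∁X = p∩q⊆q (S I) (∁ X) ∘ C⊆SX
  A∪C⊆S : A ∪ C ⊆ S I
  A∪C⊆S x∈ with x∈p∪q⁻ A C x∈
  ... | inj₁ x∈A = proj₂ (sets X X∈𝓕) (A⊆X x∈A)
  ... | inj₂ x∈C = p∩q⊆p (S I) (∁ X) (C⊆SX x∈C)
  below : ∀ {Y} → Y ∈ˡ 𝓕 I → Y ⊆ X → ∣ (A ∪ C) ∩ Y ∣ ≤ k I Y
  below Y∈𝓕 Y⊆X = ≤-trans (p⊆q⇒∣p∣≤∣q∣ (∪-∩-⊆ˡ {A = A} (p⊆q⇒∁p⊇∁q Y⊆X ∘ C⊆∁X)))
    (All.lookup boundsA (∈-filter⁺ (_⊆? X) Y∈𝓕 Y⊆X))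
  disjoint : ∀ {Y} → Y ∈ˡ 𝓕 I → X ∩ Y ≡ ∅ → ∣ (A ∪ C) ∩ Y ∣ ≤ k I Y
  disjoint {Y} Y∈𝓕 X∩Y≡∅ = ≤-trans (p⊆q⇒∣p∣≤∣q∣ (∪-∩-⊆ʳ {C = C} A⊆∁Y))
    (subst (_ ≤_) (k∖ᴵ-∈ I X Y∈𝓕) (All.lookup boundsC (∈-++⁺ˡ (∈-filter⁺ (_⊆? SX) Y∈𝓕 Y⊆SX))))
    where
    Y⊆SX : Y ⊆ SX
    Y⊆SX y∈Y = x∈p∩q⁺ (proj₂ (sets Y Y∈𝓕) y∈Y , ∩≡∅⇒⊆∁ X∩Y≡∅ y∈Y)
    A⊆∁Y : A ⊆ ∁ Y
    A⊆∁Y = ∩≡∅⇒⊆∁ (trans (∩-comm Y X) X∩Y≡∅) ∘ A⊆X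
  bound : ∀ {Y} → Y ∈ˡ 𝓕 I → X ∩ Y ≡ ∅ ⊎ (X ⊆ Y ⊎ Y ⊆ X) → ∣ (A ∪ C) ∩ Y ∣ ≤ k I Y
  bound Y∈𝓕 (inj₁ X∩Y≡∅)     = disjoint Y∈𝓕 X∩Y≡∅
  bound Y∈𝓕 (inj₂ (inj₂ Y⊆X)) = below Y∈𝓕 Y⊆X
  -- by maximality of X, a set of 𝓕 containing X is S or X itself
  bound {Y} Y∈𝓕 (inj₂ (inj₁ X⊆Y)) with Y ≟ˢ S I
  ... | yes refl = ≤-trans (p⊆q⇒∣p∣≤∣q∣ (p∩q⊆p (A ∪ C) Y)) ∣A∪C∣≤k
  ... | no Y≢S   = below Y∈𝓕 (⊆-reflexive (maximal Y Y∈𝓕 Y≢S X⊆Y))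

DP-≤∞ : ∀ {n} (J : BLM n) {q t Q} → Cand J q t Q → DP J q t ≤∞ fin (Σ[ c J ] Q)
DP-≤∞ J = IsMin.lower (DP-isMin J _ _)

combine-≤∞ : ∀ {n} {I : BLM n} {X q t Q} → S I ∈ˡ 𝓕 I → Cand I q t Q →
  combine I X q t ≤∞ fin (Σ[ c I ] Q)
combine-≤∞ {I = I} {X} {Q = Q} S∈𝓕 (ind , refl , refl)
  rewrite ∣∣-split Q X | Σ-split (p I) Q X | Σ-split (c I) Q X =
  ≤∞-trans (⊛-≤∞ (DP (I ∩ᴵ X)) (DP (I ∖ᴵ X))
                  ∣ Q ∩ X ∣ ∣ Q ∩ ∁ X ∣ (Σ[ p I ] (Q ∩ X)) (Σ[ p I ] (Q ∩ ∁ X)))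
    (+∞-mono-≤∞ (DP-≤∞ (I ∩ᴵ X) (Indep-∩ᴵ I X ind , refl , refl))
                (DP-≤∞ (I ∖ᴵ X) (Indep-∖ᴵ I X S∈𝓕 ind , refl , refl)))

Cand-∪ : ∀ {n} {I : BLM n} {X A C q t q₁ t₁} → ValidBLM I → Maximal I X →
  q ≤ k I (S I) → q₁ ≤ q → t₁ ≤ t →
  Cand (I ∩ᴵ X) q₁ t₁ A → Cand (I ∖ᴵ X) (q ∸ q₁) (t ∸ t₁) C → Cand I q t (A ∪ C)
Cand-∪ {I = I} {X} {A} {C} {q} {t} V M q≤k q₁≤q t₁≤t
       (indA@(A⊆X , _) , refl , refl) (indC@(C⊆SX , _) , ∣C∣≡ , ΣC≡) =
  Indep-∪ {I = I} {X} V M indA indC (subst (_≤ k I (S I)) (sym ∣A∪C∣≡q) q≤k) , ∣A∪C∣≡q , Σ≡t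
  where
  C⊆∁X : C ⊆ ∁ X
  C⊆∁X = p∩q⊆q (S I) (∁ X) ∘ C⊆SX
  ∣A∪C∣≡q : ∣ A ∪ C ∣ ≡ q
  ∣A∪C∣≡q = trans (∣∣-∪ A⊆X C⊆∁X) (trans (cong (∣ A ∣ +_) ∣C∣≡) (m+[n∸m]≡n q₁≤q))
  Σ≡t : Σ[ p I ] (A ∪ C) ≡ t
  Σ≡t = trans (Σ-∪ (p I) A⊆X C⊆∁X) (trans (cong (Σ[ p I ] A +_) ΣC≡) (m+[n∸m]≡n t₁≤t))

combine-isMin : ∀ {n} {I : BLM n} {X q t} → ValidBLM I → Maximal I X → q ≤ k I (S I) →
  IsMin (Cand I q t) (Σ[ c I ]_) (combine I X q t)
combine-isMin {I = I} {X} {q} {t} V@(_ , _ , S∈𝓕 , _) M q≤k =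
  record { lower = combine-≤∞ S∈𝓕 ; attained = attained }
  where
  attained : combine I X q t ≡ ∞ ⊎ ∃ λ Q → Cand I q t Q × combine I X q t ≡ fin (Σ[ c I ] Q)
  attained with ⊛-attained (DP (I ∩ᴵ X)) (DP (I ∖ᴵ X)) q t
  ... | inj₁ ∞≡ = inj₁ ∞≡
  ... | inj₂ (q₁ , t₁ , q₁≤q , t₁≤t , eq)
    with IsMin.attained (DP-isMin (I ∩ᴵ X) q₁ t₁)
       | IsMin.attained (DP-isMin (I ∖ᴵ X) (q ∸ q₁) (t ∸ t₁))
  ... | inj₁ ∞≡ | _       = inj₁ (trans eq (cong (_+∞ DP (I ∖ᴵ X) (q ∸ q₁) (t ∸ t₁)) ∞≡))
  ... | inj₂ _  | inj₁ ∞≡ = inj₁ (trans eq (trans (cong (DP (I ∩ᴵ X) q₁ t₁ +∞_) ∞≡) (x+∞∞≡∞ _)))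
  ... | inj₂ (A , candA@((A⊆X , _) , _) , eqA) | inj₂ (C , candC@((C⊆SX , _) , _) , eqC) =
    inj₂ (A ∪ C , Cand-∪ {I = I} {X} V M q≤k q₁≤q t₁≤t candA candC ,
          trans eq (trans (cong₂ _+∞_ eqA eqC)
                          (cong fin (sym (Σ-∪ (c I) {X = X} A⊆X (p∩q⊆q (S I) (∁ X) ∘ C⊆SX))))))

DP-∞ : ∀ {n} {I : BLM n} {q t} → S I ∈ˡ 𝓕 I → ¬ q ≤ k I (S I) → DP I q t ≡ ∞
DP-∞ {I = I} {q} {t} S∈𝓕 q≰k with IsMin.attained (DP-isMin I q t)
... | inj₁ ∞≡                         = ∞≡
... | inj₂ (_ , (ind , refl , _) , _) = contradiction (Indep⇒∣∣≤k I S∈𝓕 ind) q≰k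

lemma3p2 : ∀ {n} (I : BLM n) (X : Subset n) → ValidBLM I → Maximal I X →
    ∀ (q t : ℕ) → q ≤ ∣ S I ∣ → t ≤ pmax I →
      (q ≤ k I (S I) → DP I q t ≡ combine I X q t) ×
      (¬ (q ≤ k I (S I)) → DP I q t ≡ ∞)
lemma3p2 I X V@(_ , _ , S∈𝓕 , _) M q t _ _ =
  (λ q≤k → IsMin-unique (DP-isMin I q t) (combine-isMin V M q≤k)) , DP-∞ S∈𝓕
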